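{- $\mathsf{Seq}\vdash \exists y\,\forall x\,\neg\exists v_1v_2\,[(v_1\vdash x)\circ v_2=y]$.
   Context: $\mathsf{Seq}$ is the first-order theory in the language $\{e,\ \vdash,\ \circ\}$ ($e$ constant, $\vdash$ and $\circ$ binary function symbols; $x\vdash y$ is a term, not provability) with axioms: $\mathsf{Seq}_1$: $\forall x y\, [x\vdash y\neq e]$; $\mathsf{Seq}_2$: $\forall x_1x_2y_1y_2\,[x_1\vdash x_2=y_1\vdash y_2\rightarrow (x_1=y_1\wedge x_2=y_2)]$; $\mathsf{Seq}_3$: $\forall x\,[x\circ e=x]$; $\mathsf{Seq}_4$: $\forall xyz\,[x\circ(y\vdash z)=(x\circ y)\vdash z]$; $\mathsf{Seq}_5$: $\forall x\,[x=e\vee\exists yz\,[x=y\vdash z]]$. The displayed sentence is the translation of the empty-set axiom $\exists y\forall x[x\notin y]$ of $\mathsf{AST}$ under the translation $(x\in y)^\tau=\exists v_1v_2[(v_1\vdash x)\circ v_2=y]$. -}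

module Defs where

open import Level using (Level; suc)
open import Data.Product using (Σ; ∃; ∃-syntax; _×_; _,_)
open import Data.Sum using (_⊎_)
open import Relation.Binary.PropositionalEquality using (_≡_; _≢_)

record SeqModel (a : Level) : Set (suc a) where
  field
    Carrier : Set a
    e       : Carrier
    _⊢_     : Carrier → Carrier → Carrier
    _∘_     : Carrier → Carrier → Carrier
    Seq₁ : ∀ x y → (x ⊢ y) ≢ e
    Seq₂ : ∀ x₁ x₂ y₁ y₂ → (x₁ ⊢ x₂) ≡ (y₁ ⊢ y₂) → (x₁ ≡ y₁) × (x₂ ≡ y₂)
    Seq₃ : ∀ x → (x ∘ e) ≡ x
    Seq₄ : ∀ x y z → (x ∘ (y ⊢ z)) ≡ ((x ∘ y) ⊢ z)
    Seq₅ : ∀ x → (x ≡ e) ⊎ (∃[ y ] ∃[ z ] (x ≡ (y ⊢ z)))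
  infixl 6 _⊢_
  infixl 5 _∘_

-- The translated membership relation: (x ∈ y)^τ = ∃ v₁ v₂ [(v₁ ⊢ x) ∘ v₂ = y].
module _ {a : Level} (M : SeqModel a) where
  open SeqModel M
  _∈τ_ : Carrier → Carrier → Set a
  x ∈τ y = ∃[ v₁ ] ∃[ v₂ ] (((v₁ ⊢ x) ∘ v₂) ≡ y)

{-# OPTIONS --safe #-}
module Submission where

open import Defs
open import Level using (Level)
open import Algebra.Definitions using (LeftConical)
open import Data.Empty using (⊥-elim)
open import Data.Product using (∃-syntax; _,_)
open import Data.Sum using (inj₁; inj₂)
open import Relation.Nullary using (¬_)
open import Relation.Binary.PropositionalEquality using (_≡_; sym; cong; module ≡-Reasoning)
open ≡-Reasoning

-- The empty sequence e is the empty set: x ∘ v = e forces x = e, because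
-- by Seq₅ the sequence v is either e (and x ∘ e = x) or a cons y ⊢ z (and
-- then x ∘ v is a cons, never e); but v₁ ⊢ x ≠ e.

module SeqProperties {a : Level} (M : SeqModel a) where
  open SeqModel M

  ∘-conicalˡ : LeftConical _≡_ e _∘_
  ∘-conicalˡ x v x∘v≡e with Seq₅ v
  ... | inj₁ v≡e = begin
    x      ≡⟨ sym (Seq₃ x) ⟩
    x ∘ e  ≡⟨ cong (x ∘_) (sym v≡e) ⟩
    x ∘ v  ≡⟨ x∘v≡e ⟩
    e      ∎
  ... | inj₂ (y , z , v≡y⊢z) = ⊥-elim (Seq₁ (x ∘ y) z (begin
    (x ∘ y) ⊢ z  ≡⟨ sym (Seq₄ x y z) ⟩
    x ∘ (y ⊢ z)  ≡⟨ cong (x ∘_) (sym v≡y⊢z) ⟩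
    x ∘ v        ≡⟨ x∘v≡e ⟩
    e            ∎))

  e-hasNoMembers : ∀ x → ¬ (_∈τ_ M x e)
  e-hasNoMembers x (v₁ , v₂ , eq) = Seq₁ v₁ x (∘-conicalˡ (v₁ ⊢ x) v₂ eq)

lemma3 : ∀ {a : Level} (M : SeqModel a) → let open SeqModel M in ∃[ y ] (∀ x → ¬ (∃[ v₁ ] ∃[ v₂ ] (((v₁ ⊢ x) ∘ v₂) ≡ y)))
lemma3 M = SeqModel.e M , SeqProperties.e-hasNoMembers M
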